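{- Let $G$ be a connected graph with $m$ edges $e_1,\dots,e_m$ and let $H_1,\dots,H_m$ be graphs. Then a set $D\subseteq V(G\diamond(H_1,\dots,H_m))$ is a dominating set of $G\diamond(H_1,\dots,H_m)$ if and only if $V(e_i+H_i)\cap D$ is a dominating set of $e_i+H_i$ for every $e_i\in E(G)$.
   Context: For a simple graph $G$ with edge set $\{e_1,\dots,e_m\}$ and simple graphs $H_1,\dots,H_m$, the generalized edge corona product $G\diamond(H_1,\dots,H_m)$ is the graph obtained by taking one (vertex-disjoint) copy of each of $G,H_1,\dots,H_m$ and joining both end vertices of the $i$-th edge $e_i$ of $G$ to every vertex of $H_i$. For $e_i=u_iv_i$, $e_i+H_i$ denotes the subgraph of $G\diamond(H_1,\dots,H_m)$ obtained by joining the two ends $u_i,v_i$ of $e_i$ (with the edge $e_i$) to all vertices of $H_i$, i.e. the subgraph on $\{u_i,v_i\}\cup V(H_i)$ consisting of $e_i$, the edges of $H_i$, and all edges between $\{u_i,v_i\}$ and $V(H_i)$. A dominating set of a graph is a set $D$ of vertices such that every vertex not in $D$ is adjacent to some vertex of $D$. -}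

module Defs where

open import Level using (0ℓ)
open import Data.Nat using (ℕ; _≤_)
open import Data.Fin using (Fin)
open import Data.Product using (Σ; ∃; _×_; _,_; proj₁; proj₂)
open import Data.Sum using (_⊎_; inj₁; inj₂)
open import Data.Empty using (⊥)
open import Relation.Nullary using (¬_)
open import Relation.Unary using (Pred; _∩_)
open import Relation.Binary.PropositionalEquality using (_≡_)
open import Relation.Binary.Construct.Closure.ReflexiveTransitive using (Star)

record Graph : Set₁ where
  field
    order  : ℕ
    Adj    : Fin order → Fin order → Set
    sym    : ∀ {x y} → Adj x y → Adj y x
    irrefl : ∀ {x} → ¬ Adj x x
open Graph public

Connected : Graph → Set
Connected G = ∀ x y → Star (Adj G) x y

SamePair : ∀ {n} → Fin n × Fin n → Fin n × Fin n → Set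
SamePair (a , b) (c , d) = (a ≡ c × b ≡ d) ⊎ (a ≡ d × b ≡ c)

record EdgeEnum (G : Graph) (m : ℕ) : Set where
  field
    ends  : Fin m → Fin (order G) × Fin (order G)
    isEdge : ∀ i → Adj G (proj₁ (ends i)) (proj₂ (ends i))
    inj   : ∀ i j → SamePair (ends i) (ends j) → i ≡ j
    surj  : ∀ x y → Adj G x y → ∃ λ i → SamePair (ends i) (x , y)
open EdgeEnum public

-- Dominating set of the graph with vertex set S ⊆ V and adjacency A:
-- every vertex of S not in D has a neighbour in D.
-- (Used with D ⊆ S.)
Dominates : {V : Set} → Pred V 0ℓ → (V → V → Set) → Pred V 0ℓ → Set
Dominates {V} S A D = ∀ v → S v → D v ⊎ ∃ λ w → D w × A w v

module Corona (G : Graph) {m : ℕ} (E : EdgeEnum G m) (H : Fin m → Graph) where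

  u v : Fin m → Fin (order G)
  u i = proj₁ (ends E i)
  v i = proj₂ (ends E i)

  CV : Set
  CV = Fin (order G) ⊎ Σ (Fin m) (λ i → Fin (order (H i)))

  data CAdj : CV → CV → Set where
    gg : ∀ {x y} → Adj G x y → CAdj (inj₁ x) (inj₁ y)
    hh : ∀ {i a b} → Adj (H i) a b → CAdj (inj₂ (i , a)) (inj₂ (i , b))
    gh : ∀ {x i a} → (x ≡ u i ⊎ x ≡ v i) → CAdj (inj₁ x) (inj₂ (i , a))
    hg : ∀ {x i a} → (x ≡ u i ⊎ x ≡ v i) → CAdj (inj₂ (i , a)) (inj₁ x)

  All : Pred CV 0ℓ
  All _ = Data.Unit.⊤
    where import Data.Unit

  IsDominatingSet : Pred CV 0ℓ → Set
  IsDominatingSet D = Dominates All CAdj D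

  VEH : Fin m → Pred CV 0ℓ
  VEH i (inj₁ x)       = x ≡ u i ⊎ x ≡ v i
  VEH i (inj₂ (j , a)) = j ≡ i

  data EHAdj (i : Fin m) : CV → CV → Set where
    euv : EHAdj i (inj₁ (u i)) (inj₁ (v i))
    evu : EHAdj i (inj₁ (v i)) (inj₁ (u i))
    hh  : ∀ {a b} → Adj (H i) a b → EHAdj i (inj₂ (i , a)) (inj₂ (i , b))
    gh  : ∀ {x a} → (x ≡ u i ⊎ x ≡ v i) → EHAdj i (inj₁ x) (inj₂ (i , a))
    hg  : ∀ {x a} → (x ≡ u i ⊎ x ≡ v i) → EHAdj i (inj₂ (i , a)) (inj₁ x)

  IsDominatingSetEH : Fin m → Pred CV 0ℓ → Set
  IsDominatingSetEH i D = Dominates (VEH i) (EHAdj i) (VEH i ∩ D)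

module Submission where

-- (⇐) Each e_i + H_i is a subgraph of the corona, and the parts
--     V(e_i + H_i) cover all vertices: vertices of H_i trivially, and a
--     vertex x of G because G is connected with at least two vertices, so
--     the first step of a walk from x to another vertex is an edge e_i at x.
-- (⇒) A vertex of H_i only has neighbours inside e_i + H_i, and they are
--     neighbours there as well.  An endpoint x of e_i is handled through
--     some vertex h of H_i (H_i is nonempty): whatever dominates h in the
--     corona lies in V(e_i + H_i) ∩ D and is either x itself or adjacent to
--     x in e_i + H_i, because every vertex of e_i + H_i other than x is.

open import Defs
open import Level using (0ℓ)
open import Data.Nat using (ℕ; _≤_; s≤s; z≤n)
open import Data.Fin using (Fin; zero; suc)
open import Data.Product using (∃; _×_; _,_)
open import Data.Sum using (_⊎_; inj₁; inj₂)
open import Relation.Nullary using (¬_; contradiction)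
open import Relation.Unary using (Pred; _∩_)
open import Function.Bundles using (_⇔_; mk⇔)
open import Relation.Binary.PropositionalEquality using (_≡_; refl)
open import Relation.Binary.Construct.Closure.ReflexiveTransitive using (Star; ε; _◅_)

otherElement : ∀ {n} → 2 ≤ n → (x : Fin n) → ∃ λ y → ¬ x ≡ y
otherElement (s≤s (s≤s z≤n)) zero    = suc zero , λ ()
otherElement (s≤s (s≤s z≤n)) (suc x) = zero , λ ()

firstStep : ∀ {A : Set} {R : A → A → Set} {x y} →
            ¬ x ≡ y → Star R x y → ∃ λ z → R x z
firstStep x≢y ε                 = contradiction refl x≢y
firstStep _   (_◅_ {j = z} r _) = z , r

module _ (G : Graph) {m : ℕ} (E : EdgeEnum G m) (H : Fin m → Graph) where
  open Corona G E H

  partAdj⇒coronaAdj : ∀ {i s t} → EHAdj i s t → CAdj s t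
  partAdj⇒coronaAdj {i} euv    = gg (isEdge E i)
  partAdj⇒coronaAdj {i} evu    = gg (Graph.sym G (isEdge E i))
  partAdj⇒coronaAdj (hh adj) = hh adj
  partAdj⇒coronaAdj (gh p)   = gh p
  partAdj⇒coronaAdj (hg p)   = hg p

  endpointOfSomeEdge : Connected G → 2 ≤ order G →
                       ∀ x → ∃ λ i → VEH i (inj₁ x)
  endpointOfSomeEdge conn two x with otherElement two x
  ... | y , x≢y with firstStep x≢y (conn x y)
  ... | z , xz with surj E x z xz
  ... | i , inj₁ (refl , _) = i , inj₁ refl
  ... | i , inj₂ (_ , refl) = i , inj₂ refl

  partsCover : Connected G → 2 ≤ order G → ∀ s → ∃ λ i → VEH i s
  partsCover conn two (inj₁ x)       = endpointOfSomeEdge conn two x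
  partsCover conn two (inj₂ (i , _)) = i , refl

  neighbourOfPart : ∀ {w i a} → CAdj w (inj₂ (i , a)) →
                    VEH i w × EHAdj i w (inj₂ (i , a))
  neighbourOfPart (hh adj) = refl , hh adj
  neighbourOfPart (gh p)   = p , gh p

  equalOrAdjToEndpoint : ∀ {i w x} → VEH i w → VEH i (inj₁ x) →
                         w ≡ inj₁ x ⊎ EHAdj i w (inj₁ x)
  equalOrAdjToEndpoint {w = inj₂ _} refl        p           = inj₂ (hg p)
  equalOrAdjToEndpoint {w = inj₁ _} (inj₁ refl) (inj₁ refl) = inj₁ refl
  equalOrAdjToEndpoint {w = inj₁ _} (inj₂ refl) (inj₂ refl) = inj₁ refl
  equalOrAdjToEndpoint {w = inj₁ _} (inj₁ refl) (inj₂ refl) = inj₂ euv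
  equalOrAdjToEndpoint {w = inj₁ _} (inj₂ refl) (inj₁ refl) = inj₂ evu

  DominatedInPart : Fin m → Pred CV 0ℓ → CV → Set
  DominatedInPart i D t =
    (VEH i ∩ D) t ⊎ ∃ λ w → (VEH i ∩ D) w × EHAdj i w t

  dominatedVia : ∀ {i D w t} → (VEH i ∩ D) w → w ≡ t ⊎ EHAdj i w t →
                 DominatedInPart i D t
  dominatedVia wD (inj₁ refl) = inj₁ wD
  dominatedVia wD (inj₂ adj)  = inj₂ (_ , wD , adj)

  dominatorOfPartVertex : ∀ {i a} (D : Pred CV 0ℓ) →
    D (inj₂ (i , a)) ⊎ (∃ λ w → D w × CAdj w (inj₂ (i , a))) →
    ∃ λ w → (VEH i ∩ D) w × (w ≡ inj₂ (i , a) ⊎ EHAdj i w (inj₂ (i , a)))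
  dominatorOfPartVertex D (inj₁ d) = _ , (refl , d) , inj₁ refl
  dominatorOfPartVertex D (inj₂ (w , d , adj)) with neighbourOfPart adj
  ... | inW , adj′ = w , (inW , d) , inj₂ adj′

  localToGlobal : Connected G → 2 ≤ order G → (D : Pred CV 0ℓ) →
                  (∀ i → IsDominatingSetEH i D) → IsDominatingSet D
  localToGlobal conn two D local s _ with partsCover conn two s
  ... | i , inPart with local i s inPart
  ... | inj₁ (_ , d)             = inj₁ d
  ... | inj₂ (w , (_ , d) , adj) = inj₂ (w , d , partAdj⇒coronaAdj adj)

  someVertex : ∀ {n} → 1 ≤ n → Fin n
  someVertex (s≤s z≤n) = zero

  globalToLocal : (∀ i → 1 ≤ order (H i)) → (D : Pred CV 0ℓ) →
                  IsDominatingSet D → ∀ i → IsDominatingSetEH i D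
  globalToLocal _ D dom i (inj₂ (_ , a)) refl
    with dominatorOfPartVertex D (dom (inj₂ (i , a)) _)
  ... | w , wD , w≡t⊎adj = dominatedVia wD w≡t⊎adj
  globalToLocal nonempty D dom i (inj₁ x) endpoint
    with dominatorOfPartVertex D (dom (inj₂ (i , someVertex (nonempty i))) _)
  ... | w , wD@(inW , _) , _ =
    dominatedVia wD (equalOrAdjToEndpoint inW endpoint)

mainTheorem11 : (G : Graph) → Connected G → 2 ≤ order G →
    (m : ℕ) (E : EdgeEnum G m) (H : Fin m → Graph) → (∀ i → 1 ≤ order (H i)) →
    (D : Pred (Corona.CV G E H) 0ℓ) →
    Corona.IsDominatingSet G E H D ⇔ (∀ i → Corona.IsDominatingSetEH G E H i D)
mainTheorem11 G conn two m E H nonempty D =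
  mk⇔ (globalToLocal G E H nonempty D) (localToGlobal G E H conn two D)
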